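{- Let $R$ be an $n$-ary relation on $\mathbb{Q}^k$ that is preserved by $mi$, let $t^1\in R$ be min-ready, and let $t^2,\dots,t^m\in R$. If $i\in M(t^1)\cap\dots\cap M(t^m)$, $\mathrm{minx}(t^1_i)\cap\dots\cap\mathrm{minx}(t^m_i)\ne\varnothing$, $\min(t^1_i)=\dots=\min(t^m_i)$, and $j\in M(t^1)$, then also $j\in M(t^1)\cap\dots\cap M(t^m)$ and $\mathrm{minx}(t^1_j)\cap\dots\cap\mathrm{minx}(t^m_j)\ne\varnothing$.
   Context: An $n$-ary relation on $\mathbb{Q}^k$ is a nonempty set of tuples $t=(t_1,\dots,t_n)$ with $t_i\in\mathbb{Q}^k$. For $a\in\mathbb{Q}^k$, $\min(a)$ is its least entry and $\mathrm{minx}(a)=\{i:a_i=\min(a)\}$. For such $t$, $\min(t)$ is its least entry overall, $M(t)=\{i\in[n]:\min(t_i)=\min(t)\}$; $t\in R$ is min-ready in $R$ if $M(t)$ is inclusion-minimal among $\{M(s):s\in R\}$. Given strictly increasing maps $\alpha,\beta,\gamma:\mathbb{Q}\to\mathbb{Q}$ with $\alpha(x)<\beta(x)<\gamma(x)<\alpha(x+\epsilon)$ for all $x\in\mathbb{Q},\epsilon>0$, the operation $mi$ is $mi(x,y)=\alpha(\min(x,y))$ if $x=y$, $\beta(\min(x,y))$ if $x<y$, $\gamma(\min(x,y))$ if $x>y$. "$R$ is preserved by $mi$" means that $R$ is closed under componentwise application of $mi$ for every admissible choice of $\alpha,\beta,\gamma$. -}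

module Defs where

open import Data.Nat using (ℕ; zero; suc)
open import Data.Fin using (Fin; zero; suc)
open import Data.Rational using (ℚ; _<_; _+_; _⊓_; 0ℚ)
open import Data.Rational.Properties using (<-cmp)
open import Relation.Binary.Definitions using (tri<; tri≈; tri>)
open import Relation.Binary.PropositionalEquality using (_≡_)
open import Data.Product using (Σ; _×_)

Point : ℕ → Set
Point k = Fin k → ℚ

Tuple : ℕ → ℕ → Set
Tuple n k = Fin n → Point k

-- A relation = set of tuples, as a predicate. (Nonemptiness is implied by
-- the hypotheses of the lemma, since t¹ ∈ R.)
Rel : ℕ → ℕ → Set₁
Rel n k = Tuple n k → Set

minF : ∀ {k} → (Fin (suc k) → ℚ) → ℚ
minF {zero}  a = a zero
minF {suc k} a = a zero ⊓ minF (λ i → a (suc i))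

minP : ∀ {k} → Point (suc k) → ℚ
minP = minF

_∈minx_ : ∀ {k} → Fin (suc k) → Point (suc k) → Set
c ∈minx a = a c ≡ minP a

minT : ∀ {n k} → Tuple (suc n) (suc k) → ℚ
minT t = minF (λ i → minP (t i))

_∈M_ : ∀ {n k} → Fin (suc n) → Tuple (suc n) (suc k) → Set
i ∈M t = minP (t i) ≡ minT t

MinReady : ∀ {n k} → Rel (suc n) (suc k) → Tuple (suc n) (suc k) → Set
MinReady {n} {k} R t =
  R t × ((s : Tuple (suc n) (suc k)) → R s →
         (∀ i → i ∈M s → i ∈M t) → ∀ i → i ∈M t → i ∈M s)

StrictlyIncreasing : (ℚ → ℚ) → Set
StrictlyIncreasing f = ∀ x y → x < y → f x < f y

Admissible : (ℚ → ℚ) → (ℚ → ℚ) → (ℚ → ℚ) → Set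
Admissible α β γ =
  StrictlyIncreasing α × StrictlyIncreasing β × StrictlyIncreasing γ ×
  (∀ x → α x < β x) × (∀ x → β x < γ x) ×
  (∀ x ε → 0ℚ < ε → γ x < α (x + ε))

mi : (ℚ → ℚ) → (ℚ → ℚ) → (ℚ → ℚ) → ℚ → ℚ → ℚ
mi α β γ x y with <-cmp x y
... | tri< _ _ _ = β (x ⊓ y)
... | tri≈ _ _ _ = α (x ⊓ y)
... | tri> _ _ _ = γ (x ⊓ y)

miT : ∀ {n k} → (ℚ → ℚ) → (ℚ → ℚ) → (ℚ → ℚ) → Tuple n k → Tuple n k → Tuple n k
miT α β γ s t = λ i l → mi α β γ (s i l) (t i l)

PreservedByMi : ∀ {n k} → Rel n k → Set
PreservedByMi {n} {k} R =
  ∀ α β γ → Admissible α β γ →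
  (s t : Tuple n k) → R s → R t → R (miT α β γ s t)

-- Let a be the common overall minimum of t¹, …, tᵐ. Combining them with mi, each tuple first
-- raised by x ↦ mi(x, x) to the level of the combination of the others, gives S ∈ R whose entries
-- are all ≥ αᵐ⁻¹(a), with equality exactly at the positions (p, c) where every tˡ has the entry a.
-- Such a position exists (in row i), so M(S) ⊆ M(t¹); as t¹ is min-ready, j ∈ M(S), and a position
-- where S_j attains its minimum is one where every tˡ_j equals a.
--
-- Using the hypothesis needs one admissible triple. Code x ∈ ℚ in base 4 by the Stern–Brocot path
-- of an order-isomorphic positive fraction (digit 0 for a left step, 3 for a right step), followed
-- by a terminator e ∈ [¼, ¾). The codes of the descendants of a node then fall into [0, ¼) and
-- [¾, 1) after its path, on either side of all its own codes, so e = ⅜, ½, ⅝ give α, β, γ.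

{-# OPTIONS --safe #-}
module Submission where

open import Defs
open import Data.Nat using (ℕ; suc)
open import Data.Fin using (Fin; zero; suc)
open import Data.Product using (Σ; _×_; _,_; proj₁; proj₂)
open import Relation.Binary.PropositionalEquality
  using (_≡_; refl; sym; trans; cong; cong₂; subst; subst₂)

module NatRatio where
  open import Data.Nat
  open import Data.Nat.Properties

  ratio-≥1≥-≮ : ∀ {P Q P′ Q′} → Q ≤ P → P′ ≤ Q′ → P * Q′ ≮ P′ * Q
  ratio-≥1≥-≮ {P} {Q} {P′} {Q′} Q≤P P′≤Q′ = ≤⇒≯ (begin
    P′ * Q  ≤⟨ *-monoˡ-≤ Q P′≤Q′ ⟩
    Q′ * Q  ≡⟨ *-comm Q′ Q ⟩
    Q * Q′  ≤⟨ *-monoˡ-≤ Q′ Q≤P ⟩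
    P * Q′  ∎)
    where open ≤-Reasoning

  ratio-left-< : ∀ {P Q P′ Q′} → P′ ≤ Q′ → P * Q′ < P′ * Q → P * (Q′ ∸ P′) < P′ * (Q ∸ P)
  ratio-left-< {P} {Q} {P′} {Q′} P′≤Q′ lt = begin-strict
    P * (Q′ ∸ P′)      ≡⟨ *-distribˡ-∸ P Q′ P′ ⟩
    P * Q′ ∸ P * P′    <⟨ ∸-monoˡ-< lt (*-monoʳ-≤ P P′≤Q′) ⟩
    P′ * Q ∸ P * P′    ≡⟨ cong (P′ * Q ∸_) (*-comm P P′) ⟩
    P′ * Q ∸ P′ * P    ≡⟨ *-distribˡ-∸ P′ Q P ⟨
    P′ * (Q ∸ P)       ∎
    where open ≤-Reasoning

  ratio-right-< : ∀ {P Q P′ Q′} → Q ≤ P → P * Q′ < P′ * Q → (P ∸ Q) * Q′ < (P′ ∸ Q′) * Q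
  ratio-right-< {P} {Q} {P′} {Q′} Q≤P lt = begin-strict
    (P ∸ Q) * Q′       ≡⟨ *-distribʳ-∸ Q′ P Q ⟩
    P * Q′ ∸ Q * Q′    <⟨ ∸-monoˡ-< lt (*-monoˡ-≤ Q′ Q≤P) ⟩
    P′ * Q ∸ Q * Q′    ≡⟨ cong (P′ * Q ∸_) (*-comm Q Q′) ⟩
    P′ * Q ∸ Q′ * Q    ≡⟨ *-distribʳ-∸ Q P′ Q′ ⟨
    (P′ ∸ Q′) * Q      ∎
    where open ≤-Reasoning

open NatRatio

open import Data.Nat as ℕ using (zero; z≤n; s≤s)
import Data.Nat.Properties as ℕ
open import Data.Integer as ℤ using (+_; -[1+_])
import Data.Integer.Properties as ℤ
open import Data.Rational
open import Data.Rational.Properties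
open import Data.Sum using (_⊎_; inj₁; inj₂)
open import Data.Unit using (tt)
open import Function using (_∘_)
open import Relation.Binary.Definitions using (tri<; tri≈; tri>)
open import Relation.Nullary using (¬_; contradiction)
open import Relation.Nullary.Decidable using (toWitness)

module SternBrocot where

  ¼ ¾ : ℚ
  ¼ = + 1 / 4
  ¾ = + 3 / 4

  ¼<¾ : ¼ < ¾
  ¼<¾ = toWitness {a? = ¼ <? ¾} tt

  digit₀ digit₃ : ℚ → ℚ
  digit₀ v = v * ¼
  digit₃ v = ¾ + digit₀ v

  InUnit Middle : ℚ → Set
  InUnit v = 0ℚ ≤ v × v < 1ℚ
  Middle e = ¼ ≤ e × e < ¾

  digit₀-mono-< : ∀ {v w} → v < w → digit₀ v < digit₀ w
  digit₀-mono-< = *-monoˡ-<-pos ¼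

  digit₃-mono-< : ∀ {v w} → v < w → digit₃ v < digit₃ w
  digit₃-mono-< = +-monoʳ-< ¾ ∘ digit₀-mono-<

  digit₀-bounds : ∀ {v} → InUnit v → 0ℚ ≤ digit₀ v × digit₀ v < ¼
  digit₀-bounds (0≤v , v<1) = *-monoʳ-≤-nonNeg ¼ 0≤v , *-monoˡ-<-pos ¼ v<1

  digit₃-bounds : ∀ {v} → InUnit v → ¾ ≤ digit₃ v × digit₃ v < 1ℚ
  digit₃-bounds {v} v∈ =
    subst (_≤ digit₃ v) (+-identityʳ ¾) (+-monoʳ-≤ ¾ 0≤d) , +-monoʳ-< ¾ d<¼
    where
    0≤d = proj₁ (digit₀-bounds v∈)
    d<¼ = proj₂ (digit₀-bounds v∈)

  middle⇒inUnit : ∀ {e} → Middle e → InUnit e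
  middle⇒inUnit (¼≤e , e<¾) =
    ≤-trans (toWitness {a? = 0ℚ ≤? ¼} tt) ¼≤e , <-trans e<¾ (toWitness {a? = ¾ <? 1ℚ} tt)

  sbCode : (fuel P Q : ℕ) → ℚ → ℚ
  sbCode zero    P Q e = 0ℚ
  sbCode (suc f) P Q e with ℕ.<-cmp P Q
  ... | tri< _ _ _ = digit₀ (sbCode f P (Q ℕ.∸ P) e)
  ... | tri≈ _ _ _ = e
  ... | tri> _ _ _ = digit₃ (sbCode f (P ℕ.∸ Q) Q e)

  Fuelled : (fuel P Q : ℕ) → Set
  Fuelled f P Q = 0 ℕ.< P × 0 ℕ.< Q × P ℕ.+ Q ℕ.≤ f

  unfuelled : ∀ {P Q} → ¬ Fuelled 0 P Q
  unfuelled (s≤s _ , _ , ())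

  left-fuelled : ∀ {f P Q} → P ℕ.< Q → Fuelled (suc f) P Q → Fuelled f P (Q ℕ.∸ P)
  left-fuelled {f} {P} {Q} P<Q (0<P , _ , P+Q≤1+f) =
    0<P , ℕ.m<n⇒0<n∸m P<Q ,
    subst (ℕ._≤ f) (sym (ℕ.m+[n∸m]≡n (ℕ.<⇒≤ P<Q))) (ℕ.≤-pred (ℕ.<-≤-trans (ℕ.m<n+m Q 0<P) P+Q≤1+f))

  right-fuelled : ∀ {f P Q} → Q ℕ.< P → Fuelled (suc f) P Q → Fuelled f (P ℕ.∸ Q) Q
  right-fuelled {f} {P} {Q} Q<P (_ , 0<Q , P+Q≤1+f) =
    ℕ.m<n⇒0<n∸m Q<P , 0<Q ,
    subst (ℕ._≤ f) (sym (ℕ.m∸n+n≡m (ℕ.<⇒≤ Q<P))) (ℕ.≤-pred (ℕ.<-≤-trans (ℕ.m<m+n P 0<Q) P+Q≤1+f))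

  sbCode-bounds : ∀ f P Q {e} → Middle e → InUnit (sbCode f P Q e)
  sbCode-bounds zero    P Q me = ≤-refl , toWitness {a? = 0ℚ <? 1ℚ} tt
  sbCode-bounds (suc f) P Q me with ℕ.<-cmp P Q
  ... | tri< _ _ _ = let (0≤d , d<¼) = digit₀-bounds (sbCode-bounds f P (Q ℕ.∸ P) me)
                     in 0≤d , <-trans d<¼ (toWitness {a? = ¼ <? 1ℚ} tt)
  ... | tri≈ _ _ _ = middle⇒inUnit me
  ... | tri> _ _ _ = let (¾≤d , d<1) = digit₃-bounds (sbCode-bounds f (P ℕ.∸ Q) Q me)
                     in ≤-trans (toWitness {a? = 0ℚ ≤? ¾} tt) ¾≤d , d<1

  sbCode-monoˡ-< : ∀ {f P Q e e′} → Fuelled f P Q → e < e′ → sbCode f P Q e < sbCode f P Q e′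
  sbCode-monoˡ-< {zero}          fu = contradiction fu unfuelled
  sbCode-monoˡ-< {suc f} {P} {Q} fu e<e′ with ℕ.<-cmp P Q
  ... | tri< P<Q _ _ = digit₀-mono-< (sbCode-monoˡ-< (left-fuelled P<Q fu) e<e′)
  ... | tri≈ _ _ _   = e<e′
  ... | tri> _ _ Q<P = digit₃-mono-< (sbCode-monoˡ-< (right-fuelled Q<P fu) e<e′)

  digit₀-code<¼ : ∀ f P Q {e} → Middle e → digit₀ (sbCode f P Q e) < ¼
  digit₀-code<¼ f P Q me = proj₂ (digit₀-bounds (sbCode-bounds f P Q me))

  ¾≤digit₃-code : ∀ f P Q {e} → Middle e → ¾ ≤ digit₃ (sbCode f P Q e)
  ¾≤digit₃-code f P Q me = proj₁ (digit₃-bounds (sbCode-bounds f P Q me))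

  sbCode-< : ∀ {f f′ P Q P′ Q′ e e′} → Fuelled f P Q → Fuelled f′ P′ Q′ → Middle e → Middle e′ →
             P ℕ.* Q′ ℕ.< P′ ℕ.* Q → sbCode f P Q e < sbCode f′ P′ Q′ e′
  sbCode-< {zero}                              fu _  _  _   _  = contradiction fu unfuelled
  sbCode-< {suc f} {zero}                      _  fu _  _   _  = contradiction fu unfuelled
  sbCode-< {suc f} {suc f′} {P} {Q} {P′} {Q′} {e} {e′} fu fu′ me me′ lt with ℕ.<-cmp P Q | ℕ.<-cmp P′ Q′
  ... | tri< P<Q _ _ | tri< P′<Q′ _ _ = digit₀-mono-<
    (sbCode-< (left-fuelled P<Q fu) (left-fuelled P′<Q′ fu′) me me′ (ratio-left-< {P} (ℕ.<⇒≤ P′<Q′) lt))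
  ... | tri< _ _ _   | tri≈ _ _ _     = <-≤-trans (digit₀-code<¼ f P (Q ℕ.∸ P) me) (proj₁ me′)
  ... | tri< _ _ _   | tri> _ _ _     =
    <-≤-trans (<-trans (digit₀-code<¼ f P (Q ℕ.∸ P) me) ¼<¾) (¾≤digit₃-code f′ (P′ ℕ.∸ Q′) Q′ me′)
  ... | tri≈ _ P≡Q _ | tri< P′<Q′ _ _ = contradiction lt (ratio-≥1≥-≮ (ℕ.≤-reflexive (sym P≡Q)) (ℕ.<⇒≤ P′<Q′))
  ... | tri≈ _ P≡Q _ | tri≈ _ P′≡Q′ _ = contradiction lt (ratio-≥1≥-≮ (ℕ.≤-reflexive (sym P≡Q)) (ℕ.≤-reflexive P′≡Q′))
  ... | tri≈ _ _ _   | tri> _ _ _     = <-≤-trans (proj₂ me) (¾≤digit₃-code f′ (P′ ℕ.∸ Q′) Q′ me′)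
  ... | tri> _ _ Q<P | tri< P′<Q′ _ _ = contradiction lt (ratio-≥1≥-≮ (ℕ.<⇒≤ Q<P) (ℕ.<⇒≤ P′<Q′))
  ... | tri> _ _ Q<P | tri≈ _ P′≡Q′ _ = contradiction lt (ratio-≥1≥-≮ (ℕ.<⇒≤ Q<P) (ℕ.≤-reflexive P′≡Q′))
  ... | tri> _ _ Q<P | tri> _ _ Q′<P′ = digit₃-mono-<
    (sbCode-< (right-fuelled Q<P fu) (right-fuelled Q′<P′ fu′) me me′ (ratio-right-< (ℕ.<⇒≤ Q<P) lt))

  -- x ↦ x + 1 for x ≥ 0 and x ↦ 1 / (1 − x) for x < 0, as numerator and denominator:
  -- an order embedding of ℚ into the positive fractions.
  ratioNum ratioDen : ℚ → ℕ
  ratioNum (mkℚ (+ a)    d _) = a ℕ.+ suc d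
  ratioNum (mkℚ -[1+ m ] d _) = suc d
  ratioDen (mkℚ (+ a)    d _) = suc d
  ratioDen (mkℚ -[1+ m ] d _) = suc d ℕ.+ suc m

  ratio-fuelled : ∀ x → Fuelled (ratioNum x ℕ.+ ratioDen x) (ratioNum x) (ratioDen x)
  ratio-fuelled (mkℚ (+ a)    d _) = ℕ.<-≤-trans (s≤s z≤n) (ℕ.m≤n+m (suc d) a) , s≤s z≤n , ℕ.≤-refl
  ratio-fuelled (mkℚ -[1+ m ] d _) = s≤s z≤n , s≤s z≤n , ℕ.≤-refl

  ratio-< : ∀ {x y} → x < y → ratioNum x ℕ.* ratioDen y ℕ.< ratioNum y ℕ.* ratioDen x
  ratio-< {mkℚ (+ a) dx _} {mkℚ (+ b) dy _} (*<* lt) =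
    subst₂ ℕ._<_ (sym (ℕ.*-distribʳ-+ (suc dy) a (suc dx))) (sym (ℕ.*-distribʳ-+ (suc dx) b (suc dy)))
      (ℕ.+-mono-<-≤ a*dy<b*dx (ℕ.≤-reflexive (ℕ.*-comm (suc dx) (suc dy))))
    where
    a*dy<b*dx : a ℕ.* suc dy ℕ.< b ℕ.* suc dx
    a*dy<b*dx = ℤ.drop‿+<+ (subst₂ ℤ._<_ (ℤ.+◃n≡+n _) (ℤ.+◃n≡+n _) lt)
  ratio-< {mkℚ -[1+ m ] dx _} {mkℚ (+ b) dy _} _ = begin-strict
    suc dx ℕ.* suc dy             ≡⟨ ℕ.*-comm (suc dx) (suc dy) ⟩
    suc dy ℕ.* suc dx             <⟨ ℕ.*-monoʳ-< (suc dy) (ℕ.m<m+n (suc dx) (s≤s z≤n)) ⟩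
    suc dy ℕ.* (suc dx ℕ.+ suc m) ≤⟨ ℕ.*-monoˡ-≤ (suc dx ℕ.+ suc m) (ℕ.m≤n+m (suc dy) b) ⟩
    (b ℕ.+ suc dy) ℕ.* (suc dx ℕ.+ suc m) ∎
    where open ℕ.≤-Reasoning
  ratio-< {mkℚ (+ a) dx _} {mkℚ -[1+ m′ ] dy _} (*<* lt) with subst (ℤ._< _) (ℤ.+◃n≡+n _) lt
  ... | ()
  ratio-< {mkℚ -[1+ m ] dx _} {mkℚ -[1+ m′ ] dy _} (*<* lt) =
    subst₂ ℕ._<_ (sym (ℕ.*-distribˡ-+ (suc dx) (suc dy) (suc m′))) (sym (ℕ.*-distribˡ-+ (suc dy) (suc dx) (suc m)))
      (ℕ.+-mono-≤-< (ℕ.≤-reflexive (ℕ.*-comm (suc dx) (suc dy))) dx*m′<dy*m)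
    where
    dx*m′<dy*m : suc dx ℕ.* suc m′ ℕ.< suc dy ℕ.* suc m
    dx*m′<dy*m = subst₂ ℕ._<_ (ℕ.*-comm (suc m′) (suc dx)) (ℕ.*-comm (suc m) (suc dy)) (s≤s (ℤ.drop‿-<- lt))

  code : ℚ → ℚ → ℚ
  code e x = sbCode (ratioNum x ℕ.+ ratioDen x) (ratioNum x) (ratioDen x) e

  code-< : ∀ {e e′ x y} → Middle e → Middle e′ → x < y → code e x < code e′ y
  code-< {x = x} {y} me me′ x<y = sbCode-< (ratio-fuelled x) (ratio-fuelled y) me me′ (ratio-< x<y)

  code-monoˡ-< : ∀ {e e′} x → e < e′ → code e x < code e′ x
  code-monoˡ-< x = sbCode-monoˡ-< (ratio-fuelled x)

  α β γ : ℚ → ℚ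
  α = code (+ 3 / 8)
  β = code ½
  γ = code (+ 5 / 8)

  ⅜-middle : Middle (+ 3 / 8)
  ⅜-middle = toWitness {a? = ¼ ≤? + 3 / 8} tt , toWitness {a? = + 3 / 8 <? ¾} tt

  ½-middle : Middle ½
  ½-middle = toWitness {a? = ¼ ≤? ½} tt , toWitness {a? = ½ <? ¾} tt

  ⅝-middle : Middle (+ 5 / 8)
  ⅝-middle = toWitness {a? = ¼ ≤? + 5 / 8} tt , toWitness {a? = + 5 / 8 <? ¾} tt

  α-increasing : StrictlyIncreasing α
  α-increasing _ _ = code-< ⅜-middle ⅜-middle

  α<β : ∀ x → α x < β x
  α<β x = code-monoˡ-< x (toWitness {a? = + 3 / 8 <? ½} tt)

  β<γ : ∀ x → β x < γ x
  β<γ x = code-monoˡ-< x (toWitness {a? = ½ <? + 5 / 8} tt)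

  admissible : Admissible α β γ
  admissible =
    α-increasing , (λ _ _ → code-< ½-middle ½-middle) , (λ _ _ → code-< ⅝-middle ⅝-middle) , α<β , β<γ ,
    λ x ε 0<ε → code-< ⅝-middle ⅜-middle (subst (_< x + ε) (+-identityʳ x) (+-monoʳ-< x 0<ε))

minF-≤ : ∀ {k} (a : Fin (suc k) → ℚ) c → minF a ≤ a c
minF-≤ {zero}  a zero    = ≤-refl
minF-≤ {suc k} a zero    = p⊓q≤p (a zero) _
minF-≤ {suc k} a (suc c) = ≤-trans (p⊓q≤q (a zero) _) (minF-≤ (a ∘ suc) c)

minF-attained : ∀ {k} (a : Fin (suc k) → ℚ) → Σ (Fin (suc k)) λ c → a c ≡ minF a
minF-attained {zero}  a = zero , refl
minF-attained {suc k} a with ⊓-sel (a zero) (minF (a ∘ suc))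
... | inj₁ eq = zero , sym eq
... | inj₂ eq = let (c , ac≡min) = minF-attained (a ∘ suc) in suc c , trans ac≡min (sym eq)

record Floor {n k} (u : Tuple n k) (v : ℚ) (P : Fin n → Fin k → Set) : Set where
  field
    bound     : ∀ p c → v ≤ u p c
    at-floor⇒ : ∀ {p c} → u p c ≡ v → P p c
    ⇒at-floor : ∀ {p c} → P p c → u p c ≡ v

open Floor

floor-map : ∀ {n k} {u : Tuple n k} {v P Q} →
            (∀ {p c} → P p c → Q p c) → (∀ {p c} → Q p c → P p c) → Floor u v P → Floor u v Q
floor-map P⇒Q Q⇒P fl = record
  { bound = bound fl ; at-floor⇒ = P⇒Q ∘ at-floor⇒ fl ; ⇒at-floor = ⇒at-floor fl ∘ Q⇒P }

lower-bound-floor : ∀ {n k} {u : Tuple n k} {v} → (∀ p c → v ≤ u p c) → Floor u v (λ p c → u p c ≡ v)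
lower-bound-floor v≤u = record { bound = v≤u ; at-floor⇒ = λ eq → eq ; ⇒at-floor = λ eq → eq }

module _ {n k : ℕ} where

  minT-≤ : ∀ (t : Tuple (suc n) (suc k)) p c → minT t ≤ t p c
  minT-≤ t p c = ≤-trans (minF-≤ (minP ∘ t) p) (minF-≤ (t p) c)

  ∈M-attained : ∀ (t : Tuple (suc n) (suc k)) {p} → p ∈M t → Σ (Fin (suc k)) λ c → t p c ≡ minT t
  ∈M-attained t {p} p∈M = let (c , c∈minx) = minF-attained (t p) in c , trans c∈minx p∈M

  minT-attained : ∀ (t : Tuple (suc n) (suc k)) → Σ (Fin (suc n)) λ p → Σ (Fin (suc k)) λ c → t p c ≡ minT t
  minT-attained t = let (p , p∈M) = minF-attained (minP ∘ t) in p , ∈M-attained t p∈M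

  entry-at-minT : ∀ (t : Tuple (suc n) (suc k)) {p c} → t p c ≡ minT t → p ∈M t × c ∈minx t p
  entry-at-minT t {p} {c} eq = p∈M , trans eq (sym p∈M)
    where
    p∈M : p ∈M t
    p∈M = ≤-antisym (subst (minP (t p) ≤_) eq (minF-≤ (t p) c)) (minF-≤ (minP ∘ t) p)

  minT-floor : ∀ {t : Tuple (suc n) (suc k)} {v P p c} → Floor t v P → P p c → minT t ≡ v
  minT-floor {t} {p = p} {c} fl Ppc =
    let (p′ , c′ , t-p′c′≡min) = minT-attained t
    in ≤-antisym (subst (minT t ≤_) (⇒at-floor fl Ppc) (minT-≤ t p c))
                 (subst (_ ≤_) t-p′c′≡min (bound fl p′ c′))

  min-ready-floor : ∀ {R : Rel (suc n) (suc k)} {t S v P i c} →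
                    MinReady R t → R S → Floor S v P → P i c → (∀ {p c} → P p c → t p c ≡ minT t) →
                    ∀ {j} → j ∈M t → Σ (Fin (suc k)) (P j)
  min-ready-floor {t = t} {S} {v} (_ , minimal) RS flS Pic P⇒min j∈M =
    let (c′ , S-jc′≡min) = ∈M-attained S (minimal S RS M[S]⊆M[t] _ j∈M)
    in c′ , at-floor⇒ flS (trans S-jc′≡min minT≡v)
    where
    minT≡v : minT S ≡ v
    minT≡v = minT-floor flS Pic
    M[S]⊆M[t] : ∀ p → p ∈M S → p ∈M t
    M[S]⊆M[t] p p∈M =
      let (c , S-pc≡min) = ∈M-attained S p∈M
      in proj₁ (entry-at-minT t (P⇒min (at-floor⇒ flS (trans S-pc≡min minT≡v))))

<⇒≱ : ∀ {x y} → x < y → ¬ y ≤ x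
<⇒≱ x<y y≤x = <-irrefl refl (<-≤-trans x<y y≤x)

iterate : {A : Set} → (A → A) → ℕ → A → A
iterate f zero    x = x
iterate f (suc r) x = f (iterate f r x)

mi-diag : ∀ α β γ x → mi α β γ x x ≡ α x
mi-diag α β γ x with <-cmp x x
... | tri< x<x _ _ = contradiction x<x (<-irrefl refl)
... | tri≈ _ _ _   = cong α (⊓-idem x)
... | tri> _ _ x>x = contradiction x>x (<-irrefl refl)

module _ {α β γ : ℚ → ℚ} (α-increasing : StrictlyIncreasing α)
         (α<β : ∀ x → α x < β x) (β<γ : ∀ x → β x < γ x) where

  α-mono-≤ : ∀ {x y} → x ≤ y → α x ≤ α y
  α-mono-≤ {x} {y} x≤y with <-cmp x y
  ... | tri< x<y _ _ = <⇒≤ (α-increasing x y x<y)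
  ... | tri≈ _ refl _ = ≤-refl
  ... | tri> _ _ y<x = contradiction x≤y (<⇒≱ y<x)

  mi-floor : ∀ {v x y} → v ≤ x → v ≤ y → (x ≡ v × y ≡ v) ⊎ α v < mi α β γ x y
  mi-floor {v} {x} {y} v≤x v≤y with <-cmp x y
  ... | tri< _ _ _ = inj₂ (≤-<-trans (α-mono-≤ (⊓-glb v≤x v≤y)) (α<β _))
  ... | tri> _ _ _ = inj₂ (≤-<-trans (α-mono-≤ (⊓-glb v≤x v≤y)) (<-trans (α<β _) (β<γ _)))
  ... | tri≈ _ refl _ with <-cmp v x
  ...   | tri< v<x _ _ = inj₂ (subst (α v <_) (cong α (sym (⊓-idem x))) (α-increasing v x v<x))
  ...   | tri≈ _ refl _ = inj₁ (refl , refl)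
  ...   | tri> _ _ x<v = contradiction v≤x (<⇒≱ x<v)

  miT-floor : ∀ {n k} {u w : Tuple n k} {v P P′} →
              Floor u v P → Floor w v P′ → Floor (miT α β γ u w) (α v) (λ p c → P p c × P′ p c)
  miT-floor {u = u} {w} {v} {P} {P′} flu flw = record { bound = bnd ; at-floor⇒ = at⇒ ; ⇒at-floor = ⇒at }
    where
    mi-at-floor : ∀ {x y} → x ≡ v → y ≡ v → mi α β γ x y ≡ α v
    mi-at-floor x≡v y≡v = trans (cong₂ (mi α β γ) x≡v y≡v) (mi-diag α β γ v)
    bnd : ∀ p c → α v ≤ mi α β γ (u p c) (w p c)
    bnd p c with mi-floor (bound flu p c) (bound flw p c)
    ... | inj₁ (u≡v , w≡v) = ≤-reflexive (sym (mi-at-floor u≡v w≡v))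
    ... | inj₂ αv<mi = <⇒≤ αv<mi
    at⇒ : ∀ {p c} → mi α β γ (u p c) (w p c) ≡ α v → P p c × P′ p c
    at⇒ {p} {c} eq with mi-floor (bound flu p c) (bound flw p c)
    ... | inj₁ (u≡v , w≡v) = at-floor⇒ flu u≡v , at-floor⇒ flw w≡v
    ... | inj₂ αv<mi = contradiction (sym eq) (<⇒≢ αv<mi)
    ⇒at : ∀ {p c} → P p c × P′ p c → mi α β γ (u p c) (w p c) ≡ α v
    ⇒at (Pp , P′p) = mi-at-floor (⇒at-floor flu Pp) (⇒at-floor flw P′p)

  module _ {n k : ℕ} {R : Rel n k} (closed : ∀ s t → R s → R t → R (miT α β γ s t)) where

    raise : ℕ → Tuple n k → Tuple n k
    raise = iterate (λ u → miT α β γ u u)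

    raise-floor : ∀ r {u v P} → R u → Floor u v P → R (raise r u) × Floor (raise r u) (iterate α r v) P
    raise-floor zero    Ru flu = Ru , flu
    raise-floor (suc r) Ru flu =
      let (Rw , flw) = raise-floor r Ru flu
      in closed _ _ Rw Rw , floor-map proj₁ (λ Ppc → Ppc , Ppc) (miT-floor flw flw)

    combine : ∀ m (ts : Fin (suc m) → Tuple n k) {a} → (∀ l → R (ts l)) → (∀ l p c → a ≤ ts l p c) →
              Σ (Tuple n k) λ S → R S × Floor S (iterate α m a) (λ p c → ∀ l → ts l p c ≡ a)
    combine zero    ts Rts a≤ts =
      ts zero , Rts zero , floor-map (λ { eq zero → eq }) (λ eqs → eqs zero) (lower-bound-floor (a≤ts zero))
    combine (suc m) ts Rts a≤ts =
      let (S , RS , flS)   = combine m (ts ∘ suc) (Rts ∘ suc) (a≤ts ∘ suc)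
          (Rt₀ , flt₀)     = raise-floor m (Rts zero) (lower-bound-floor (a≤ts zero))
      in miT α β γ (raise m (ts zero)) S , closed _ _ Rt₀ RS ,
         floor-map (λ { (eq₀ , eqs) zero → eq₀ ; (eq₀ , eqs) (suc l) → eqs l }) (λ eqs → eqs zero , eqs ∘ suc)
                   (miT-floor flt₀ flS)

  module _ {n k : ℕ} {R : Rel (suc n) (suc k)} (closed : ∀ s t → R s → R t → R (miT α β γ s t)) where

    min-ready⇒common-min-entry :
      ∀ {m} (ts : Fin (suc m) → Tuple (suc n) (suc k)) {a} →
      MinReady R (ts zero) → (∀ l → R (ts l)) → (∀ l → minT (ts l) ≡ a) →
      ∀ {i c} → (∀ l → ts l i c ≡ a) →
      ∀ {j} → j ∈M ts zero → Σ (Fin (suc k)) λ c′ → ∀ l → ts l j c′ ≡ a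
    min-ready⇒common-min-entry {m} ts {a} ready Rts minT≡a common =
      let (S , RS , flS) = combine closed m ts Rts a≤ts
      in min-ready-floor ready RS flS common (λ eqs → trans (eqs zero) (sym (minT≡a zero)))
      where
      a≤ts : ∀ l p c → a ≤ ts l p c
      a≤ts l p c = subst (_≤ ts l p c) (minT≡a l) (minT-≤ (ts l) p c)

lemma5p3 : (n k m : ℕ) (R : Rel (suc n) (suc k)) → PreservedByMi R →
    (ts : Fin (suc m) → Tuple (suc n) (suc k)) →
    MinReady R (ts zero) → (∀ l → R (ts l)) →
    (i j : Fin (suc n)) →
    (∀ l → i ∈M ts l) →
    Σ (Fin (suc k)) (λ c → ∀ l → c ∈minx ts l i) →
    (∀ l → minP (ts l i) ≡ minP (ts zero i)) →
    j ∈M ts zero →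
    (∀ l → j ∈M ts l) × Σ (Fin (suc k)) (λ c → ∀ l → c ∈minx ts l j)
lemma5p3 n k m R preserved ts ready Rts i j i∈M (c , c∈minx) minᵢ≡ j∈M =
  let (c′ , ts-jc′≡a) = min-ready⇒common-min-entry α-increasing α<β β<γ (preserved α β γ admissible)
                          ts ready Rts minT≡a (λ l → trans (c∈minx l) (minᵢ≡ l)) j∈M
      at-minT = λ l → entry-at-minT (ts l) (trans (ts-jc′≡a l) (sym (minT≡a l)))
  in (proj₁ ∘ at-minT) , c′ , (proj₂ ∘ at-minT)
  where
  open SternBrocot using (α; β; γ; α-increasing; α<β; β<γ; admissible)
  minT≡a : ∀ l → minT (ts l) ≡ minP (ts zero i)
  minT≡a l = trans (sym (i∈M l)) (minᵢ≡ l)
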